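{- Let $\mathcal{H}=(V,\mathcal{E})$ be a Sperner hypergraph in $\mathcal{L}_0$ and let $e_0\in\mathcal{E}$ with $|e_0|>2$. Then $\mathcal{H}-e_0\in\mathcal{L}_0$ and $(\mathcal{H}/e_0)^*\in\mathcal{L}_0$.
   Context: A hypergraph $\mathcal{H}=(V,\mathcal{E})$ consists of a finite vertex set $V$ and a set $\mathcal{E}$ of non-empty subsets of $V$ (edges). A cycle in $\mathcal{H}$ is a sequence $(v_1,e_1,\ldots,v_t,e_t,v_1)$ with $t\ge2$, pairwise distinct vertices $v_1,\ldots,v_t$, pairwise distinct edges $e_1,\ldots,e_t$, and $\{v_i,v_{i+1}\}\subseteq e_i$ ($v_{t+1}=v_1$); it is also written $(e_1,\ldots,e_t)$. $\mathcal{L}_0$ is the set of hypergraphs in which every edge has even size and every cycle $(e_1,\ldots,e_r)$ has distinct vertices $u,v\in\bigcup_i e_i$ with $\{u,v\}$ an edge. $\mathcal{H}$ is Sperner if no edge is contained in a different edge. $\mathcal{H}-e_0$ is obtained by removing the edge $e_0$. For $V_0\subseteq V$, $\mathcal{H}\cdot V_0$ is the hypergraph with vertex set $(V\setminus V_0)\cup\{w\}$ ($w$ a new vertex) and edge set $\{e\in\mathcal{E}:e\cap V_0=\emptyset\}\cup\{(e\setminus V_0)\cup\{w\}: e\in\mathcal{E}, e\cap V_0\ne\emptyset\}$; $\mathcal{H}/e_0=(\mathcal{H}-e_0)\cdot e_0$. For a hypergraph $(V',\mathcal{E}')$, its Sperner subhypergraph $(V',\mathcal{E}'^*)$ is obtained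 by removing every edge that properly contains another edge; $(\mathcal{H}/e_0)^*$ denotes the Sperner subhypergraph of $\mathcal{H}/e_0$. -}

module Defs where

open import Data.Nat using (ℕ; zero; suc; _≤_)
import Data.Nat as ℕ
open import Data.Nat.Divisibility using (_∣_)
open import Data.Fin using (Fin; zero; suc; toℕ; lower₁)
open import Data.Fin.Subset using (Subset; inside; outside; _∈_; _⊆_; _∩_; _∪_; _─_; ⁅_⁆; ∣_∣; Nonempty; Empty)
open import Data.Vec using (_∷_)
open import Data.Product using (Σ; _×_; ∃)
open import Data.Sum using (_⊎_)
open import Relation.Nullary using (¬_; yes; no)
open import Relation.Binary.PropositionalEquality using (_≡_; _≢_)
open import Function.Definitions using (Injective)
open import Level using (Level) renaming (suc to lsuc)

record Hypergraph (n : ℕ) : Set₁ where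
  field
    V : Subset n
    E : Subset n → Set

open Hypergraph public

WellFormed : ∀ {n} → Hypergraph n → Set
WellFormed H = ∀ e → E H e → Nonempty e × e ⊆ V H

cycSuc : ∀ {m} → Fin (suc m) → Fin (suc m)
cycSuc {m} i with m ℕ.≟ toℕ i
... | yes _ = zero
... | no ne = suc (lower₁ i ne)

-- A cycle (v_1,e_1,...,v_t,e_t,v_1), t ≥ 2, indexed by Fin t with t = suc m.
record Cycle {n : ℕ} (H : Hypergraph n) : Set where
  field
    m      : ℕ
    t≥2    : 2 ≤ suc m
    vtx    : Fin (suc m) → Fin n
    edg    : Fin (suc m) → Subset n
    vtx-inj : Injective _≡_ _≡_ vtx
    edg-inj : Injective _≡_ _≡_ edg
    edg-E   : ∀ i → E H (edg i)
    vtx∈    : ∀ i → vtx i ∈ edg i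
    vtxSuc∈ : ∀ i → vtx (cycSuc i) ∈ edg i

open Cycle public

InCycleUnion : ∀ {n} {H : Hypergraph n} → Cycle H → Fin n → Set
InCycleUnion C u = ∃ λ i → u ∈ edg C i

InL0 : ∀ {n} → Hypergraph n → Set
InL0 {n} H =
  (∀ e → E H e → 2 ∣ ∣ e ∣)
  × ((C : Cycle H) → Σ (Fin n) λ u → Σ (Fin n) λ v →
        InCycleUnion C u × InCycleUnion C v × u ≢ v × E H (⁅ u ⁆ ∪ ⁅ v ⁆))

Sperner : ∀ {n} → Hypergraph n → Set
Sperner H = ∀ e f → E H e → E H f → e ⊆ f → e ≡ f

removeEdge : ∀ {n} → Hypergraph n → Subset n → Hypergraph n
removeEdge H e₀ = record { V = V H ; E = λ e → E H e × e ≢ e₀ }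

-- H · V₀ : vertex set Fin (suc n), the new vertex w is `zero`,
-- old vertex i becomes `suc i`.
contract : ∀ {n} → Hypergraph n → Subset n → Hypergraph (suc n)
contract H V₀ = record
  { V = inside ∷ (V H ─ V₀)
  ; E = λ e' → Σ (Subset _) λ e → E H e ×
        ((Empty (e ∩ V₀) × e' ≡ outside ∷ e)
         ⊎ (Nonempty (e ∩ V₀) × e' ≡ inside ∷ (e ─ V₀)))
  }

contractEdge : ∀ {n} → Hypergraph n → Subset n → Hypergraph (suc n)
contractEdge H e₀ = contract (removeEdge H e₀) e₀

spernerSub : ∀ {n} → Hypergraph n → Hypergraph n
spernerSub H = record
  { V = V H
  ; E = λ e → E H e × ¬ (Σ (Subset _) λ f → E H f × f ⊆ e × f ≢ e)
  }

-- Deleting e₀ keeps every cycle of H, and its chord {u, v} is not e₀ because |e₀| > 2.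
-- For the contraction, let squash collapse e₀ to the new vertex w; every edge of H/e₀ is the
-- squash-image of an edge of H other than e₀. A cycle of H/e₀ lifts to a cycle of H: vertex by vertex
-- if it avoids w; if it passes through w, its two edges at w meet e₀ in vertices y and x, and the lift
-- closes up directly when x = y and through e₀ otherwise. A chord of the lift squashes to a chord of
-- the original cycle (Sperner and |e₀| > 2 keep its ends apart), and pairs are minimal edges of H/e₀,
-- so they survive in (H/e₀)*. For parity, an edge f = (e ∖ e₀) ∪ {w} of (H/e₀)* has |f| = |e| when e
-- meets e₀ in one vertex; otherwise the 2-cycle (e, e₀) has a chord that squashes to a pair inside f,
-- and minimality forces f to be that pair.

module Submission where

open import Defs
open import Data.Bool.Properties using () renaming (_≟_ to _≟ᵇ_)
open import Data.Empty using (⊥-elim)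
open import Data.Fin using (Fin; zero; suc; toℕ; fromℕ; punchOut) renaming (_≟_ to _≟ᶠ_)
open import Data.Fin.Properties
  using (toℕ-injective; toℕ-fromℕ; toℕ-lower₁; toℕ<n; 0≢1+n; suc-injective;
         punchOut-injective; punchIn-punchOut; any?)
open import Data.Fin.Subset
  using (Subset; inside; outside; _∈_; _∉_; _⊆_; _∩_; _∪_; _─_; _-_; ⁅_⁆; ∣_∣; Nonempty; Empty)
open import Data.Fin.Subset.Properties
  using (_∈?_; nonempty?; ⊆-antisym; p⊆q⇒∣p∣≤∣q∣; x∈⁅x⁆; x∈⁅y⁆⇒x≡y; ∣⁅x⁆∣≡1; x∈p∩q⁺; p∩q⊆p; p∩q⊆q;
         x∈p∪q⁺; x∈p∪q⁻; x∈p∧x∉q⇒x∈p─q; p─q⊆p; x∈p∧x≢y⇒x∈p-y; x∈p⇒∣p-x∣<∣p∣)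
open import Data.Nat using (ℕ; zero; suc; _+_; _≤_; _<_; z≤n; s≤s)
import Data.Nat.Properties as ℕ
open import Data.Nat.Divisibility using (_∣_; ∣-refl; ∣1⇒≡1)
open import Data.Product using (Σ; ∃; _×_; _,_; proj₁; proj₂)
open import Data.Sum using (_⊎_; inj₁; inj₂)
open import Data.Vec.Base using ([]; _∷_; here; there)
open import Data.Vec.Properties using (≡-dec)
open import Function using (_∘_)
open import Function.Definitions using (Injective)
open import Relation.Binary.PropositionalEquality
  using (_≡_; _≢_; refl; sym; trans; cong; cong₂; subst; module ≡-Reasoning)
open import Relation.Nullary using (¬_; yes; no; contradiction)
open import Relation.Nullary.Decidable using (decidable-stable)

cycSuc-last : ∀ {m} (i : Fin (suc m)) → toℕ i ≡ m → cycSuc i ≡ zero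
cycSuc-last {m} i i≡m with m ℕ.≟ toℕ i
... | yes _ = refl
... | no m≢i = ⊥-elim (m≢i (sym i≡m))

toℕ-cycSuc : ∀ {m} (i : Fin (suc m)) → toℕ i ≢ m → toℕ (cycSuc i) ≡ suc (toℕ i)
toℕ-cycSuc {m} i i≢m with m ℕ.≟ toℕ i
... | yes m≡i = ⊥-elim (i≢m (sym m≡i))
... | no m≢i = cong suc (toℕ-lower₁ i m≢i)

cycSuc-fromℕ : ∀ m → cycSuc (fromℕ m) ≡ zero
cycSuc-fromℕ m = cycSuc-last (fromℕ m) (toℕ-fromℕ m)

cycSuc-injective : ∀ {m} → Injective _≡_ _≡_ (cycSuc {m})
cycSuc-injective {m} {i} {j} eq with toℕ i ℕ.≟ m | toℕ j ℕ.≟ m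
... | yes i≡m | yes j≡m = toℕ-injective (trans i≡m (sym j≡m))
... | yes i≡m | no j≢m =
  ⊥-elim (ℕ.0≢1+n (trans (cong toℕ (trans (sym (cycSuc-last i i≡m)) eq)) (toℕ-cycSuc j j≢m)))
... | no i≢m | yes j≡m =
  ⊥-elim (ℕ.0≢1+n (trans (cong toℕ (trans (sym (cycSuc-last j j≡m)) (sym eq))) (toℕ-cycSuc i i≢m)))
... | no i≢m | no j≢m =
  toℕ-injective (ℕ.suc-injective (trans (sym (toℕ-cycSuc i i≢m)) (trans (cong toℕ eq) (toℕ-cycSuc j j≢m))))

cycSuc≡zero⇒≡fromℕ : ∀ {m} {i : Fin (suc m)} → cycSuc i ≡ zero → i ≡ fromℕ m
cycSuc≡zero⇒≡fromℕ {m} eq = cycSuc-injective (trans eq (sym (cycSuc-fromℕ m)))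

cycSuc-zero : ∀ m → cycSuc {suc m} zero ≡ suc zero
cycSuc-zero m = toℕ-injective (toℕ-cycSuc {suc m} zero (λ ()))

cycSuc-suc : ∀ {m} (i : Fin (suc m)) → i ≢ fromℕ m → cycSuc (suc i) ≡ suc (cycSuc i)
cycSuc-suc {m} i i≢last =
  toℕ-injective (trans (toℕ-cycSuc (suc i) (i≢m ∘ ℕ.suc-injective)) (cong suc (sym (toℕ-cycSuc i i≢m))))
  where
  i≢m : toℕ i ≢ m
  i≢m i≡m = i≢last (toℕ-injective (trans i≡m (sym (toℕ-fromℕ m))))

cycSuc^ : ∀ {m} → ℕ → Fin (suc m) → Fin (suc m)
cycSuc^ zero i = i
cycSuc^ (suc k) i = cycSuc (cycSuc^ k i)

cycSuc^-cycSuc : ∀ {m} k (i : Fin (suc m)) → cycSuc^ k (cycSuc i) ≡ cycSuc (cycSuc^ k i)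
cycSuc^-cycSuc zero i = refl
cycSuc^-cycSuc (suc k) i = cong cycSuc (cycSuc^-cycSuc k i)

cycSuc^-injective : ∀ {m} k → Injective _≡_ _≡_ (cycSuc^ {m} k)
cycSuc^-injective zero eq = eq
cycSuc^-injective (suc k) eq = cycSuc^-injective k (cycSuc-injective eq)

toℕ-cycSuc^-zero : ∀ {m} k → k ≤ m → toℕ (cycSuc^ {m} k zero) ≡ k
toℕ-cycSuc^-zero zero _ = refl
toℕ-cycSuc^-zero (suc k) k<m =
  trans (toℕ-cycSuc _ (λ eq → ℕ.<-irrefl (trans (sym ih) eq) k<m)) (cong suc ih)
  where
  ih : toℕ (cycSuc^ k zero) ≡ k
  ih = toℕ-cycSuc^-zero k (ℕ.<⇒≤ k<m)

cycSuc^-zero : ∀ {m} (j : Fin (suc m)) → cycSuc^ (toℕ j) zero ≡ j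
cycSuc^-zero j = toℕ-injective (toℕ-cycSuc^-zero (toℕ j) (ℕ.≤-pred (toℕ<n j)))

Subsingleton : ∀ {n} → Subset n → Set
Subsingleton p = ∀ {x y} → x ∈ p → y ∈ p → x ≡ y

Nontrivial : ∀ {n} → Subset n → Set
Nontrivial {n} p = Σ (Fin n) λ x → Σ (Fin n) λ y → x ∈ p × y ∈ p × x ≢ y

x∈p⇒⁅x⁆⊆p : ∀ {n} {p : Subset n} {x} → x ∈ p → ⁅ x ⁆ ⊆ p
x∈p⇒⁅x⁆⊆p {p = p} {x} x∈p y∈⁅x⁆ = subst (_∈ p) (sym (x∈⁅y⁆⇒x≡y x y∈⁅x⁆)) x∈p

subsingleton⇒≡⁅x⁆ : ∀ {n} {p : Subset n} {x} → Subsingleton p → x ∈ p → p ≡ ⁅ x ⁆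
subsingleton⇒≡⁅x⁆ {p = p} {x} single x∈p = ⊆-antisym
  (λ y∈p → subst (_∈ ⁅ x ⁆) (single x∈p y∈p) (x∈⁅x⁆ x))
  (x∈p⇒⁅x⁆⊆p x∈p)

x∈p─q⇒x∉q : ∀ {n} {p q : Subset n} {x} → x ∈ p ─ q → x ∉ q
x∈p─q⇒x∉q {p = _ ∷ p} {_ ∷ q} (there x∈p─q) (there x∈q) = x∈p─q⇒x∉q {p = p} {q} x∈p─q x∈q
x∈p─q⇒x∉q {p = _ ∷ p} {inside ∷ q} () here

p⊈q⇒p─q≢∅ : ∀ {n} {p q : Subset n} → ¬ (p ⊆ q) → Nonempty (p ─ q)
p⊈q⇒p─q≢∅ {p = p} {q} p⊈q with nonempty? (p ─ q)
... | yes p─q≢∅ = p─q≢∅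
... | no p─q≡∅ = ⊥-elim (p⊈q p⊆q)
  where
  p⊆q : p ⊆ q
  p⊆q {x} x∈p with x ∈? q
  ... | yes x∈q = x∈q
  ... | no x∉q = ⊥-elim (p─q≡∅ (x , x∈p∧x∉q⇒x∈p─q x∈p x∉q))

∈-pair⁻ : ∀ {n} {x y z : Fin n} → z ∈ ⁅ x ⁆ ∪ ⁅ y ⁆ → z ≡ x ⊎ z ≡ y
∈-pair⁻ {x = x} {y} z∈ with x∈p∪q⁻ ⁅ x ⁆ ⁅ y ⁆ z∈
... | inj₁ z∈⁅x⁆ = inj₁ (x∈⁅y⁆⇒x≡y x z∈⁅x⁆)
... | inj₂ z∈⁅y⁆ = inj₂ (x∈⁅y⁆⇒x≡y y z∈⁅y⁆)

x∈pair : ∀ {n} (x y : Fin n) → x ∈ ⁅ x ⁆ ∪ ⁅ y ⁆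
x∈pair x y = x∈p∪q⁺ (inj₁ (x∈⁅x⁆ x))

y∈pair : ∀ {n} (x y : Fin n) → y ∈ ⁅ x ⁆ ∪ ⁅ y ⁆
y∈pair x y = x∈p∪q⁺ (inj₂ (x∈⁅x⁆ y))

pair⊆ : ∀ {n} {x y : Fin n} {p} → x ∈ p → y ∈ p → ⁅ x ⁆ ∪ ⁅ y ⁆ ⊆ p
pair⊆ x∈p y∈p z∈ with ∈-pair⁻ z∈
... | inj₁ refl = x∈p
... | inj₂ refl = y∈p

∈-pair-map : ∀ {n n′} (g : Fin n → Fin n′) {x y z} → z ∈ ⁅ x ⁆ ∪ ⁅ y ⁆ → g z ∈ ⁅ g x ⁆ ∪ ⁅ g y ⁆
∈-pair-map g z∈ with ∈-pair⁻ z∈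
... | inj₁ refl = x∈pair _ _
... | inj₂ refl = y∈pair _ _

Empty-∩⇒∉ : ∀ {n} {p q : Subset n} {x} → Empty (p ∩ q) → x ∈ p → x ∉ q
Empty-∩⇒∉ p∩q≡∅ x∈p x∈q = p∩q≡∅ (_ , x∈p∩q⁺ (x∈p , x∈q))

nontrivial-⊆-pair : ∀ {n} {p} {x y : Fin n} → Nontrivial p → p ⊆ ⁅ x ⁆ ∪ ⁅ y ⁆ → ⁅ x ⁆ ∪ ⁅ y ⁆ ⊆ p
nontrivial-⊆-pair (a , b , a∈p , b∈p , a≢b) p⊆ with ∈-pair⁻ (p⊆ a∈p) | ∈-pair⁻ (p⊆ b∈p)
... | inj₁ refl | inj₁ refl = ⊥-elim (a≢b refl)
... | inj₁ refl | inj₂ refl = pair⊆ a∈p b∈p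
... | inj₂ refl | inj₁ refl = pair⊆ b∈p a∈p
... | inj₂ refl | inj₂ refl = ⊥-elim (a≢b refl)

subsingleton⊎nontrivial : ∀ {n} (p : Subset n) → Subsingleton p ⊎ Nontrivial p
subsingleton⊎nontrivial [] = inj₁ λ ()
subsingleton⊎nontrivial (b ∷ p) with subsingleton⊎nontrivial p
... | inj₂ (x , y , x∈p , y∈p , x≢y) =
  inj₂ (suc x , suc y , there x∈p , there y∈p , x≢y ∘ suc-injective)
subsingleton⊎nontrivial (outside ∷ p) | inj₁ single =
  inj₁ λ { (there x∈p) (there y∈p) → cong suc (single x∈p y∈p) }
subsingleton⊎nontrivial (inside ∷ p) | inj₁ single with nonempty? p
... | yes (x , x∈p) = inj₂ (zero , suc x , here , there x∈p , 0≢1+n)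
... | no p≡∅ = inj₁ λ
  { here here → refl
  ; here (there y∈p) → ⊥-elim (p≡∅ (_ , y∈p))
  ; (there x∈p) _ → ⊥-elim (p≡∅ (_ , x∈p)) }

even-nonempty⇒nontrivial : ∀ {n} {p : Subset n} → 2 ∣ ∣ p ∣ → Nonempty p → Nontrivial p
even-nonempty⇒nontrivial {p = p} even (x , x∈p) with subsingleton⊎nontrivial p
... | inj₂ nontrivial = nontrivial
... | inj₁ single = contradiction (∣1⇒≡1 (subst (2 ∣_) ∣p∣≡1 even)) λ ()
  where
  ∣p∣≡1 : ∣ p ∣ ≡ 1
  ∣p∣≡1 = trans (cong ∣_∣ (subsingleton⇒≡⁅x⁆ single x∈p)) (∣⁅x⁆∣≡1 x)

∣p∪q∣≤∣p∣+∣q∣ : ∀ {n} (p q : Subset n) → ∣ p ∪ q ∣ ≤ ∣ p ∣ + ∣ q ∣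
∣p∪q∣≤∣p∣+∣q∣ [] [] = z≤n
∣p∪q∣≤∣p∣+∣q∣ (outside ∷ p) (outside ∷ q) = ∣p∪q∣≤∣p∣+∣q∣ p q
∣p∪q∣≤∣p∣+∣q∣ (outside ∷ p) (inside ∷ q) =
  ℕ.≤-trans (s≤s (∣p∪q∣≤∣p∣+∣q∣ p q)) (ℕ.≤-reflexive (sym (ℕ.+-suc ∣ p ∣ ∣ q ∣)))
∣p∪q∣≤∣p∣+∣q∣ (inside ∷ p) (outside ∷ q) = s≤s (∣p∪q∣≤∣p∣+∣q∣ p q)
∣p∪q∣≤∣p∣+∣q∣ (inside ∷ p) (inside ∷ q) =
  s≤s (ℕ.≤-trans (ℕ.m≤n⇒m≤1+n (∣p∪q∣≤∣p∣+∣q∣ p q)) (ℕ.≤-reflexive (sym (ℕ.+-suc ∣ p ∣ ∣ q ∣))))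

∣p∣≡∣p∩q∣+∣p─q∣ : ∀ {n} (p q : Subset n) → ∣ p ∣ ≡ ∣ p ∩ q ∣ + ∣ p ─ q ∣
∣p∣≡∣p∩q∣+∣p─q∣ [] [] = refl
∣p∣≡∣p∩q∣+∣p─q∣ (outside ∷ p) (outside ∷ q) = ∣p∣≡∣p∩q∣+∣p─q∣ p q
∣p∣≡∣p∩q∣+∣p─q∣ (outside ∷ p) (inside ∷ q) = ∣p∣≡∣p∩q∣+∣p─q∣ p q
∣p∣≡∣p∩q∣+∣p─q∣ (inside ∷ p) (outside ∷ q) =
  trans (cong suc (∣p∣≡∣p∩q∣+∣p─q∣ p q)) (sym (ℕ.+-suc ∣ p ∩ q ∣ ∣ p ─ q ∣))
∣p∣≡∣p∩q∣+∣p─q∣ (inside ∷ p) (inside ∷ q) = cong suc (∣p∣≡∣p∩q∣+∣p─q∣ p q)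

∣pair∣≤2 : ∀ {n} (x y : Fin n) → ∣ ⁅ x ⁆ ∪ ⁅ y ⁆ ∣ ≤ 2
∣pair∣≤2 x y = subst (∣ ⁅ x ⁆ ∪ ⁅ y ⁆ ∣ ≤_) (cong₂ _+_ (∣⁅x⁆∣≡1 x) (∣⁅x⁆∣≡1 y)) (∣p∪q∣≤∣p∣+∣q∣ ⁅ x ⁆ ⁅ y ⁆)

nontrivial⇒2≤∣p∣ : ∀ {n} {p : Subset n} → Nontrivial p → 2 ≤ ∣ p ∣
nontrivial⇒2≤∣p∣ {p = p} (x , y , x∈p , y∈p , x≢y) =
  ℕ.≤-trans (s≤s 1≤∣p-x∣) (x∈p⇒∣p-x∣<∣p∣ x∈p)
  where
  1≤∣p-x∣ : 1 ≤ ∣ p - x ∣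
  1≤∣p-x∣ = subst (_≤ ∣ p - x ∣) (∣⁅x⁆∣≡1 y) (p⊆q⇒∣p∣≤∣q∣ (x∈p⇒⁅x⁆⊆p (x∈p∧x≢y⇒x∈p-y y∈p (x≢y ∘ sym))))

∣pair∣≡2 : ∀ {n} {x y : Fin n} → x ≢ y → ∣ ⁅ x ⁆ ∪ ⁅ y ⁆ ∣ ≡ 2
∣pair∣≡2 {x = x} {y} x≢y =
  ℕ.≤-antisym (∣pair∣≤2 x y) (nontrivial⇒2≤∣p∣ (x , y , x∈pair x y , y∈pair x y , x≢y))

pair≢ : ∀ {n} {q : Subset n} → 2 < ∣ q ∣ → ∀ x y → ⁅ x ⁆ ∪ ⁅ y ⁆ ≢ q
pair≢ 2<∣q∣ x y refl = ℕ.<⇒≱ 2<∣q∣ (∣pair∣≤2 x y)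

weakenCycle : ∀ {n} {H H′ : Hypergraph n} → (∀ {e} → E H e → E H′ e) → Cycle H → Cycle H′
weakenCycle H⊆H′ C = record
  { m = m C ; t≥2 = t≥2 C ; vtx = vtx C ; edg = edg C ; vtx-inj = vtx-inj C ; edg-inj = edg-inj C
  ; edg-E = H⊆H′ ∘ edg-E C ; vtx∈ = vtx∈ C ; vtxSuc∈ = vtxSuc∈ C }

rotate : ∀ {n} {H : Hypergraph n} (C : Cycle H) → Fin (suc (m C)) → Cycle H
rotate C j = record
  { m = m C ; t≥2 = t≥2 C ; vtx = vtx C ∘ shift ; edg = edg C ∘ shift
  ; vtx-inj = cycSuc^-injective (toℕ j) ∘ vtx-inj C
  ; edg-inj = cycSuc^-injective (toℕ j) ∘ edg-inj C
  ; edg-E = edg-E C ∘ shift ; vtx∈ = vtx∈ C ∘ shift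
  ; vtxSuc∈ = λ i → subst (_∈ edg C (shift i)) (cong (vtx C) (sym (cycSuc^-cycSuc (toℕ j) i)))
                          (vtxSuc∈ C (shift i)) }
  where
  shift = cycSuc^ (toℕ j)

rotate-vtx-zero : ∀ {n} {H : Hypergraph n} (C : Cycle H) j → vtx (rotate C j) zero ≡ vtx C j
rotate-vtx-zero C j = cong (vtx C) (cycSuc^-zero j)

rotate-union : ∀ {n} {H : Hypergraph n} (C : Cycle H) j {u} → InCycleUnion (rotate C j) u → InCycleUnion C u
rotate-union C j (i , u∈) = cycSuc^ (toℕ j) i , u∈

module TwoCycle {n} {H : Hypergraph n} {u v : Fin n} {e e′ : Subset n}
  (e-E : E H e) (e′-E : E H e′) (e≢e′ : e ≢ e′) (u≢v : u ≢ v)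
  (u∈e : u ∈ e) (v∈e : v ∈ e) (u∈e′ : u ∈ e′) (v∈e′ : v ∈ e′) where

  vertex : Fin 2 → Fin n
  vertex zero = u
  vertex (suc zero) = v

  edge : Fin 2 → Subset n
  edge zero = e
  edge (suc zero) = e′

  cycle : Cycle H
  cycle = record
    { m = 1 ; t≥2 = s≤s (s≤s z≤n) ; vtx = vertex ; edg = edge
    ; vtx-inj = λ { {zero} {zero} _ → refl ; {zero} {suc zero} → ⊥-elim ∘ u≢v
                  ; {suc zero} {zero} → ⊥-elim ∘ u≢v ∘ sym ; {suc zero} {suc zero} _ → refl }
    ; edg-inj = λ { {zero} {zero} _ → refl ; {zero} {suc zero} → ⊥-elim ∘ e≢e′
                  ; {suc zero} {zero} → ⊥-elim ∘ e≢e′ ∘ sym ; {suc zero} {suc zero} _ → refl }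
    ; edg-E = λ { zero → e-E ; (suc zero) → e′-E }
    ; vtx∈ = λ { zero → u∈e ; (suc zero) → v∈e′ }
    ; vtxSuc∈ = λ { zero → v∈e ; (suc zero) → u∈e′ } }

  cycle-union : ∀ {a} → InCycleUnion cycle a → a ∈ e ⊎ a ∈ e′
  cycle-union (zero , a∈e) = inj₁ a∈e
  cycle-union (suc zero , a∈e′) = inj₂ a∈e′

-- The path ℓ 0, ed 0, ℓ 1, …, ℓ m, ed m, x closed up by the edge e ∋ x, ℓ 0; x becomes vertex 0.
module ClosedPath {n} {H : Hypergraph n} {m} {x : Fin n} {e : Subset n}
  (ℓ : Fin (suc m) → Fin n) (ed : Fin (suc m) → Subset n)
  (ℓ-inj : Injective _≡_ _≡_ ℓ) (ed-inj : Injective _≡_ _≡_ ed)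
  (ed-E : ∀ i → E H (ed i)) (e-E : E H e) (ℓ≢x : ∀ i → ℓ i ≢ x) (ed≢e : ∀ i → ed i ≢ e)
  (ℓ∈ed : ∀ i → ℓ i ∈ ed i) (ℓsuc∈ed : ∀ i → i ≢ fromℕ m → ℓ (cycSuc i) ∈ ed i)
  (x∈ed : x ∈ ed (fromℕ m)) (x∈e : x ∈ e) (ℓ₀∈e : ℓ zero ∈ e) where

  vertex : Fin (suc (suc m)) → Fin n
  vertex zero = x
  vertex (suc i) = ℓ i

  edge : Fin (suc (suc m)) → Subset n
  edge zero = e
  edge (suc i) = ed i

  vertex-injective : Injective _≡_ _≡_ vertex
  vertex-injective {zero} {zero} _ = refl
  vertex-injective {zero} {suc j} eq = ⊥-elim (ℓ≢x j (sym eq))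
  vertex-injective {suc i} {zero} eq = ⊥-elim (ℓ≢x i eq)
  vertex-injective {suc i} {suc j} eq = cong suc (ℓ-inj eq)

  edge-injective : Injective _≡_ _≡_ edge
  edge-injective {zero} {zero} _ = refl
  edge-injective {zero} {suc j} eq = ⊥-elim (ed≢e j (sym eq))
  edge-injective {suc i} {zero} eq = ⊥-elim (ed≢e i eq)
  edge-injective {suc i} {suc j} eq = cong suc (ed-inj eq)

  edge-E : ∀ i → E H (edge i)
  edge-E zero = e-E
  edge-E (suc i) = ed-E i

  vertex∈edge : ∀ i → vertex i ∈ edge i
  vertex∈edge zero = x∈e
  vertex∈edge (suc i) = ℓ∈ed i

  successor∈edge : ∀ i → vertex (cycSuc i) ∈ edge i
  successor∈edge zero rewrite cycSuc-zero m = ℓ₀∈e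
  successor∈edge (suc i) with i ≟ᶠ fromℕ m
  ... | yes refl rewrite cycSuc-fromℕ (suc m) = x∈ed
  ... | no i≢last rewrite cycSuc-suc i i≢last = ℓsuc∈ed i i≢last

  cycle : Cycle H
  cycle = record
    { m = suc m ; t≥2 = s≤s (s≤s z≤n) ; vtx = vertex ; edg = edge
    ; vtx-inj = vertex-injective ; edg-inj = edge-injective ; edg-E = edge-E
    ; vtx∈ = vertex∈edge ; vtxSuc∈ = successor∈edge }

  cycle-union : ∀ {a} → InCycleUnion cycle a → a ∈ e ⊎ ∃ λ i → a ∈ ed i
  cycle-union (zero , a∈e) = inj₁ a∈e
  cycle-union (suc i , a∈ed) = inj₂ (i , a∈ed)

PairEdge : ∀ {n} → Hypergraph n → (Fin n → Set) → Set
PairEdge {n} H P = Σ (Fin n) λ u → Σ (Fin n) λ v → P u × P v × u ≢ v × E H (⁅ u ⁆ ∪ ⁅ v ⁆)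

mapPairEdge : ∀ {n} {H H′ : Hypergraph n} {P Q : Fin n → Set} → (∀ {u} → P u → Q u) →
  (∀ {u v} → E H (⁅ u ⁆ ∪ ⁅ v ⁆) → E H′ (⁅ u ⁆ ∪ ⁅ v ⁆)) → PairEdge H P → PairEdge H′ Q
mapPairEdge P⇒Q H⇒H′ (u , v , Pu , Pv , u≢v , uv-E) = u , v , P⇒Q Pu , P⇒Q Pv , u≢v , H⇒H′ uv-E

module Contraction {n} (V₀ : Subset n) where

  squash : Fin n → Fin (suc n)
  squash a with a ∈? V₀
  ... | yes _ = zero
  ... | no _ = suc a

  squash-∈ : ∀ {a} → a ∈ V₀ → squash a ≡ zero
  squash-∈ {a} a∈V₀ with a ∈? V₀
  ... | yes _ = refl
  ... | no a∉V₀ = ⊥-elim (a∉V₀ a∈V₀)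

  squash-∉ : ∀ {a} → a ∉ V₀ → squash a ≡ suc a
  squash-∉ {a} a∉V₀ with a ∈? V₀
  ... | yes a∈V₀ = ⊥-elim (a∉V₀ a∈V₀)
  ... | no _ = refl

  squash≡zero⇒∈ : ∀ {a} → squash a ≡ zero → a ∈ V₀
  squash≡zero⇒∈ {a} eq with a ∈? V₀
  ... | yes a∈V₀ = a∈V₀
  ... | no _ = ⊥-elim (0≢1+n (sym eq))

  squash≡suc⇒ : ∀ {a b} → squash a ≡ suc b → a ≡ b × a ∉ V₀
  squash≡suc⇒ {a} eq with a ∈? V₀
  ... | yes _ = ⊥-elim (0≢1+n eq)
  ... | no a∉V₀ = suc-injective eq , a∉V₀

  squash-injective : ∀ {a b} → squash a ≡ squash b → a ≡ b ⊎ (a ∈ V₀ × b ∈ V₀)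
  squash-injective {a} {b} eq with a ∈? V₀ | b ∈? V₀
  ... | yes a∈V₀ | yes b∈V₀ = inj₂ (a∈V₀ , b∈V₀)
  ... | yes _ | no _ = ⊥-elim (0≢1+n eq)
  ... | no _ | yes _ = ⊥-elim (0≢1+n (sym eq))
  ... | no _ | no _ = inj₁ (suc-injective eq)

  image : Subset n → Subset (suc n)
  image e with nonempty? (e ∩ V₀)
  ... | yes _ = inside ∷ (e ─ V₀)
  ... | no _ = outside ∷ e

  image-shape : ∀ e → (Empty (e ∩ V₀) × image e ≡ outside ∷ e)
                    ⊎ (Nonempty (e ∩ V₀) × image e ≡ inside ∷ (e ─ V₀))
  image-shape e with nonempty? (e ∩ V₀)
  ... | yes e∩V₀≢∅ = inj₂ (e∩V₀≢∅ , refl)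
  ... | no e∩V₀≡∅ = inj₁ (e∩V₀≡∅ , refl)

  module Edges (H : Hypergraph n) where

    image-edge : ∀ {e} → E H e → E (contract H V₀) (image e)
    image-edge {e} e-E = e , e-E , image-shape e

    squash∈edge : ∀ {f} (k : E (contract H V₀) f) {a} → a ∈ proj₁ k → squash a ∈ f
    squash∈edge (e , _ , inj₁ (e∩V₀≡∅ , refl)) a∈e =
      subst (_∈ outside ∷ e) (sym (squash-∉ (Empty-∩⇒∉ e∩V₀≡∅ a∈e))) (there a∈e)
    squash∈edge (e , _ , inj₂ (_ , refl)) {a} a∈e with a ∈? V₀
    ... | yes _ = here
    ... | no a∉V₀ = there (x∈p∧x∉q⇒x∈p─q a∈e a∉V₀)

    ∈edge⇒squash : ∀ {f} (k : E (contract H V₀) f) {x} → x ∈ f → ∃ λ a → a ∈ proj₁ k × squash a ≡ x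
    ∈edge⇒squash (e , _ , inj₁ (e∩V₀≡∅ , refl)) {suc a} (there a∈e) =
      a , a∈e , squash-∉ (Empty-∩⇒∉ e∩V₀≡∅ a∈e)
    ∈edge⇒squash (e , _ , inj₂ ((u , u∈e∩V₀) , refl)) here =
      u , p∩q⊆p e V₀ u∈e∩V₀ , squash-∈ (p∩q⊆q e V₀ u∈e∩V₀)
    ∈edge⇒squash (e , _ , inj₂ (_ , refl)) {suc a} (there a∈e─V₀) =
      a , p─q⊆p e V₀ a∈e─V₀ , squash-∉ (x∈p─q⇒x∉q a∈e─V₀)

    edge⊆ : ∀ {f q} (k : E (contract H V₀) f) → (∀ {a} → a ∈ proj₁ k → squash a ∈ q) → f ⊆ q
    edge⊆ k squash∈q x∈f with ∈edge⇒squash k x∈f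
    ... | a , a∈ , refl = squash∈q a∈

    edge-determined : ∀ {f g} (k : E (contract H V₀) f) (k′ : E (contract H V₀) g) →
                      proj₁ k ≡ proj₁ k′ → f ≡ g
    edge-determined k k′ eq = ⊆-antisym
      (edge⊆ k (squash∈edge k′ ∘ subst (_ ∈_) eq))
      (edge⊆ k′ (squash∈edge k ∘ subst (_ ∈_) (sym eq)))

    suc∈edge⇒ : ∀ {f} (k : E (contract H V₀) f) {b} → suc b ∈ f → b ∈ proj₁ k × b ∉ V₀
    suc∈edge⇒ k sb∈f with ∈edge⇒squash k sb∈f
    ... | a , a∈ , eq with squash≡suc⇒ eq
    ... | refl , a∉V₀ = a∈ , a∉V₀

    zero∈edge⇒ : ∀ {f} (k : E (contract H V₀) f) → zero ∈ f → ∃ λ a → a ∈ proj₁ k × a ∈ V₀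
    zero∈edge⇒ k w∈f with ∈edge⇒squash k w∈f
    ... | a , a∈ , eq = a , a∈ , squash≡zero⇒∈ eq

    contract-pair : ∀ {a b} → E H (⁅ a ⁆ ∪ ⁅ b ⁆) → E (contract H V₀) (⁅ squash a ⁆ ∪ ⁅ squash b ⁆)
    contract-pair {a} {b} ab-E = subst (E (contract H V₀)) image≡ k
      where
      k : E (contract H V₀) (image (⁅ a ⁆ ∪ ⁅ b ⁆))
      k = image-edge ab-E
      image≡ : image (⁅ a ⁆ ∪ ⁅ b ⁆) ≡ ⁅ squash a ⁆ ∪ ⁅ squash b ⁆
      image≡ = ⊆-antisym (edge⊆ k (∈-pair-map squash))
        (pair⊆ (squash∈edge k (x∈pair a b)) (squash∈edge k (y∈pair a b)))

spernerSub-minimal : ∀ {n} {H : Hypergraph n} {f g} → E (spernerSub H) f → E H g → g ⊆ f → g ≡ f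
spernerSub-minimal (_ , minimal) g-E g⊆f =
  decidable-stable (≡-dec _≟ᵇ_ _ _) (λ g≢f → minimal (_ , g-E , g⊆f , g≢f))

spernerSub-pair : ∀ {n} {H : Hypergraph n} {u v} → (∀ {e} → E H e → Nontrivial e) →
  E H (⁅ u ⁆ ∪ ⁅ v ⁆) → E (spernerSub H) (⁅ u ⁆ ∪ ⁅ v ⁆)
spernerSub-pair nontrivial uv-E =
  uv-E , λ (f , f-E , f⊆ , f≢) → f≢ (⊆-antisym f⊆ (nontrivial-⊆-pair (nontrivial f-E) f⊆))

removeEdge-InL0 : ∀ {n} {H : Hypergraph n} {e₀} → InL0 H → 2 < ∣ e₀ ∣ → InL0 (removeEdge H e₀)
removeEdge-InL0 {H = H} {e₀} (even , chord) 2<∣e₀∣ =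
  (λ e (e-E , _) → even e e-E) ,
  λ C → mapPairEdge {H = H} {H′ = removeEdge H e₀} (λ u∈ → u∈) (λ {u} {v} uv-E → uv-E , pair≢ 2<∣e₀∣ u v)
          (chord (weakenCycle proj₁ C))

module ContractionOfEdge {n} {H : Hypergraph n} (wf : WellFormed H) (sp : Sperner H) (L : InL0 H)
  {e₀ : Subset n} (e₀-E : E H e₀) (2<∣e₀∣ : 2 < ∣ e₀ ∣) where

  open Contraction e₀
  open Edges (removeEdge H e₀)

  K : Hypergraph (suc n)
  K = contractEdge H e₀

  S : Hypergraph (suc n)
  S = spernerSub K

  edge-nontrivial : ∀ {e} → E H e → Nontrivial e
  edge-nontrivial {e} e-E = even-nonempty⇒nontrivial (proj₁ L e e-E) (proj₁ (wf e e-E))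

  K-nontrivial : ∀ {f} → E K f → Nontrivial f
  K-nontrivial k@(e , (e-E , e≢e₀) , _)
    with edge-nontrivial e-E | p⊈q⇒p─q≢∅ (e≢e₀ ∘ sp e e₀ e-E e₀-E)
  ... | a , b , a∈e , b∈e , a≢b | c , c∈e─e₀ with squash a ≟ᶠ squash b
  ...   | no sa≢sb = squash a , squash b , squash∈edge k a∈e , squash∈edge k b∈e , sa≢sb
  ...   | yes sa≡sb with squash-injective sa≡sb
  ...     | inj₁ a≡b = ⊥-elim (a≢b a≡b)
  ...     | inj₂ (a∈e₀ , _) =
    squash a , squash c , squash∈edge k a∈e , squash∈edge k (p─q⊆p e e₀ c∈e─e₀) ,
    λ sa≡sc → x∈p─q⇒x∉q c∈e─e₀ (squash≡zero⇒∈ (trans (sym sa≡sc) (squash-∈ a∈e₀)))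

  squashPairEdge : ∀ {P : Fin (suc n) → Set} {Q : Fin n → Set} →
    (∀ {a} → Q a → P (squash a)) → PairEdge H Q → PairEdge K P
  squashPairEdge Q⇒P (a , b , Qa , Qb , a≢b , ab-E) =
    squash a , squash b , Q⇒P Qa , Q⇒P Qb , sa≢sb , contract-pair (ab-E , pair≢ 2<∣e₀∣ a b)
    where
    sa≢sb : squash a ≢ squash b
    sa≢sb sa≡sb with squash-injective sa≡sb
    ... | inj₁ a≡b = a≢b a≡b
    ... | inj₂ (a∈e₀ , b∈e₀) = pair≢ 2<∣e₀∣ a b (sp _ e₀ ab-E e₀-E (pair⊆ a∈e₀ b∈e₀))

  pair-inside : ∀ {f} (k : E K f) → zero ∈ f → Nontrivial (proj₁ k ∩ e₀) → PairEdge K (_∈ f)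
  pair-inside {f} k@(e , (e-E , e≢e₀) , _) w∈f (u , v , u∈e∩e₀ , v∈e∩e₀ , u≢v) =
    squashPairEdge covers (proj₂ L D.cycle)
    where
    module D = TwoCycle {H = H} e-E e₀-E e≢e₀ u≢v (p∩q⊆p e e₀ u∈e∩e₀) (p∩q⊆p e e₀ v∈e∩e₀)
      (p∩q⊆q e e₀ u∈e∩e₀) (p∩q⊆q e e₀ v∈e∩e₀)
    covers : ∀ {a} → InCycleUnion D.cycle a → squash a ∈ f
    covers a∈ with D.cycle-union a∈
    ... | inj₁ a∈e = squash∈edge k a∈e
    ... | inj₂ a∈e₀ = subst (_∈ f) (sym (squash-∈ a∈e₀)) w∈f

  S-even : ∀ f → E S f → 2 ∣ ∣ f ∣
  S-even f ((e , (e-E , _) , inj₁ (_ , refl)) , _) = proj₁ L e e-E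
  S-even f f-S@((e , (e-E , _) , inj₂ ((u , u∈e∩e₀) , refl)) , _) with subsingleton⊎nontrivial (e ∩ e₀)
  ... | inj₁ single = subst (2 ∣_) ∣e∣≡∣f∣ (proj₁ L e e-E)
    where
    open ≡-Reasoning
    ∣e∣≡∣f∣ : ∣ e ∣ ≡ suc ∣ e ─ e₀ ∣
    ∣e∣≡∣f∣ = begin
      ∣ e ∣                         ≡⟨ ∣p∣≡∣p∩q∣+∣p─q∣ e e₀ ⟩
      ∣ e ∩ e₀ ∣ + ∣ e ─ e₀ ∣       ≡⟨ cong (λ p → ∣ p ∣ + ∣ e ─ e₀ ∣) (subsingleton⇒≡⁅x⁆ single u∈e∩e₀) ⟩
      ∣ ⁅ u ⁆ ∣ + ∣ e ─ e₀ ∣        ≡⟨ cong (_+ ∣ e ─ e₀ ∣) (∣⁅x⁆∣≡1 u) ⟩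
      suc ∣ e ─ e₀ ∣                ∎
  ... | inj₂ nontrivial with pair-inside (proj₁ f-S) here nontrivial
  ... | s , t , s∈f , t∈f , s≢t , st-K =
    subst (λ g → 2 ∣ ∣ g ∣) (spernerSub-minimal {H = K} f-S st-K (pair⊆ s∈f t∈f))
      (subst (2 ∣_) (sym (∣pair∣≡2 s≢t)) ∣-refl)

  module LiftCycle (C : Cycle K) where

    preimage : Fin (suc (m C)) → Subset n
    preimage i = proj₁ (edg-E C i)

    preimage-E : ∀ i → E H (preimage i)
    preimage-E i = proj₁ (proj₁ (proj₂ (edg-E C i)))

    preimage≢e₀ : ∀ i → preimage i ≢ e₀
    preimage≢e₀ i = proj₂ (proj₁ (proj₂ (edg-E C i)))

    preimage-injective : Injective _≡_ _≡_ preimage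
    preimage-injective {i} {j} eq = edg-inj C (edge-determined (edg-E C i) (edg-E C j) eq)

    squash-covers : ∀ {i a} → a ∈ preimage i → InCycleUnion C (squash a)
    squash-covers {i} a∈ = i , squash∈edge (edg-E C i) a∈

    liftVertex∈preimage : ∀ {i j} (w≢vᵢ : zero ≢ vtx C i) → vtx C i ∈ edg C j → punchOut w≢vᵢ ∈ preimage j
    liftVertex∈preimage {j = j} w≢vᵢ vᵢ∈ =
      proj₁ (suc∈edge⇒ (edg-E C j) (subst (_∈ edg C j) (sym (punchIn-punchOut w≢vᵢ)) vᵢ∈))

    liftVertex∉e₀ : ∀ {i} (w≢vᵢ : zero ≢ vtx C i) → punchOut w≢vᵢ ∉ e₀
    liftVertex∉e₀ {i} w≢vᵢ =
      proj₂ (suc∈edge⇒ (edg-E C i) (subst (_∈ edg C i) (sym (punchIn-punchOut w≢vᵢ)) (vtx∈ C i)))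

    chord-of-lift : (ℓ : Fin (suc (m C)) → Fin n) → Injective _≡_ _≡_ ℓ →
      (∀ i → ℓ i ∈ preimage i) → (∀ i → ℓ (cycSuc i) ∈ preimage i) → PairEdge K (InCycleUnion C)
    chord-of-lift ℓ ℓ-inj ℓ∈ ℓsuc∈ = squashPairEdge (λ (_ , a∈) → squash-covers a∈) (proj₂ L lifted)
      where
      lifted : Cycle H
      lifted = record
        { m = m C ; t≥2 = t≥2 C ; vtx = ℓ ; edg = preimage ; vtx-inj = ℓ-inj
        ; edg-inj = preimage-injective ; edg-E = preimage-E ; vtx∈ = ℓ∈ ; vtxSuc∈ = ℓsuc∈ }

    chord-avoiding : (∀ i → zero ≢ vtx C i) → PairEdge K (InCycleUnion C)
    chord-avoiding w∉C = chord-of-lift (λ i → punchOut (w∉C i))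
      (λ {i} {j} eq → vtx-inj C (punchOut-injective (w∉C i) (w∉C j) eq))
      (λ i → liftVertex∈preimage (w∉C i) (vtx∈ C i))
      (λ i → liftVertex∈preimage (w∉C (cycSuc i)) (vtxSuc∈ C i))

    module ThroughNewVertex (v₀≡w : vtx C zero ≡ zero) where

      last : Fin (suc (m C))
      last = fromℕ (m C)

      w≢vₛ : ∀ k → zero ≢ vtx C (suc k)
      w≢vₛ k w≡vₛ = 0≢1+n (vtx-inj C (trans v₀≡w w≡vₛ))

      w∈first : zero ∈ edg C zero
      w∈first = subst (_∈ edg C zero) v₀≡w (vtx∈ C zero)

      w∈last : zero ∈ edg C last
      w∈last = subst (_∈ edg C last) (trans (cong (vtx C) (cycSuc-fromℕ (m C))) v₀≡w) (vtxSuc∈ C last)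

      lift : Fin n → Fin (suc (m C)) → Fin n
      lift y zero = y
      lift y (suc k) = punchOut (w≢vₛ k)

      lift-∈ : ∀ y i {j} → vtx C i ∈ edg C j → (i ≡ zero → y ∈ preimage j) → lift y i ∈ preimage j
      lift-∈ y zero _ y∈ = y∈ refl
      lift-∈ y (suc k) vᵢ∈ _ = liftVertex∈preimage (w≢vₛ k) vᵢ∈

      lift-injective : ∀ {y} → y ∈ e₀ → Injective _≡_ _≡_ (lift y)
      lift-injective y∈e₀ {zero} {zero} _ = refl
      lift-injective y∈e₀ {zero} {suc k} eq = ⊥-elim (liftVertex∉e₀ (w≢vₛ k) (subst (_∈ e₀) eq y∈e₀))
      lift-injective y∈e₀ {suc k} {zero} eq = ⊥-elim (liftVertex∉e₀ (w≢vₛ k) (subst (_∈ e₀) (sym eq) y∈e₀))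
      lift-injective y∈e₀ {suc k} {suc k′} eq = vtx-inj C (punchOut-injective (w≢vₛ k) (w≢vₛ k′) eq)

      lift∈preimage : ∀ {y} → y ∈ preimage zero → ∀ i → lift y i ∈ preimage i
      lift∈preimage y∈ i = lift-∈ _ i (vtx∈ C i) (λ i≡0 → subst (λ j → _ ∈ preimage j) (sym i≡0) y∈)

      chord-closed : ∀ {y} → y ∈ preimage zero → y ∈ e₀ → y ∈ preimage last → PairEdge K (InCycleUnion C)
      chord-closed {y} y∈first y∈e₀ y∈last =
        chord-of-lift (lift y) (lift-injective y∈e₀) (lift∈preimage y∈first) λ i → lift-∈ y (cycSuc i) (vtxSuc∈ C i)
          (λ vₛ≡0 → subst (λ j → y ∈ preimage j) (sym (cycSuc≡zero⇒≡fromℕ vₛ≡0)) y∈last)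

      chord-open : ∀ {x y} → x ≢ y → y ∈ preimage zero → y ∈ e₀ → x ∈ preimage last → x ∈ e₀ →
        PairEdge K (InCycleUnion C)
      chord-open {x} {y} x≢y y∈first y∈e₀ x∈last x∈e₀ = squashPairEdge covers (proj₂ L P.cycle)
        where
        lift≢x : ∀ i → lift y i ≢ x
        lift≢x zero = x≢y ∘ sym
        lift≢x (suc k) eq = liftVertex∉e₀ (w≢vₛ k) (subst (_∈ e₀) (sym eq) x∈e₀)
        module P = ClosedPath {H = H} (lift y) preimage (lift-injective y∈e₀) preimage-injective
          preimage-E e₀-E lift≢x preimage≢e₀ (lift∈preimage y∈first)
          (λ i i≢last → lift-∈ y (cycSuc i) (vtxSuc∈ C i) (⊥-elim ∘ i≢last ∘ cycSuc≡zero⇒≡fromℕ))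
          x∈last x∈e₀ y∈e₀
        covers : ∀ {a} → InCycleUnion P.cycle a → InCycleUnion C (squash a)
        covers a∈ with P.cycle-union a∈
        ... | inj₁ a∈e₀ = zero , subst (_∈ edg C zero) (sym (squash-∈ a∈e₀)) w∈first
        ... | inj₂ (_ , a∈) = squash-covers a∈

      chord : PairEdge K (InCycleUnion C)
      chord with zero∈edge⇒ (edg-E C zero) w∈first | zero∈edge⇒ (edg-E C last) w∈last
      ... | y , y∈first , y∈e₀ | x , x∈last , x∈e₀ with x ≟ᶠ y
      ...   | yes refl = chord-closed y∈first y∈e₀ x∈last
      ...   | no x≢y = chord-open x≢y y∈first y∈e₀ x∈last x∈e₀

  K-chord : (C : Cycle K) → PairEdge K (InCycleUnion C)
  K-chord C with any? (λ j → vtx C j ≟ᶠ zero)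
  ... | yes (j , vⱼ≡w) = mapPairEdge {H = K} {H′ = K} (rotate-union C j) (λ uv-K → uv-K)
    (LiftCycle.ThroughNewVertex.chord (rotate C j) (trans (rotate-vtx-zero C j) vⱼ≡w))
  ... | no w∉C = LiftCycle.chord-avoiding C (λ i w≡vᵢ → w∉C (i , sym w≡vᵢ))

  S-InL0 : InL0 S
  S-InL0 = S-even , λ C →
    mapPairEdge {H = K} {H′ = S} (λ u∈ → u∈) (spernerSub-pair {H = K} K-nontrivial) (K-chord (weakenCycle proj₁ C))

lemma3p2 : ∀ {n : ℕ} (H : Hypergraph n) → WellFormed H → Sperner H → InL0 H →
    (e₀ : Subset n) → E H e₀ → 2 < ∣ e₀ ∣ →
    InL0 (removeEdge H e₀) × InL0 (spernerSub (contractEdge H e₀))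
lemma3p2 H wf sp L e₀ e₀-E 2<∣e₀∣ = removeEdge-InL0 L 2<∣e₀∣ , ContractionOfEdge.S-InL0 wf sp L e₀-E 2<∣e₀∣
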